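{- Let $d\ge1$, $r\ge2$ and $k$ be integers with $\lceil r/2\rceil<k\le r$. Then there exist pairwise disjoint finite point sets $C_0,C_1,\dots,C_d\subseteq\mathbb{R}^d$, where $|C_1|=\dots=|C_d|=r$ and $|C_0|=r-1$, such that for any $r$ pairwise disjoint sets $X_1,\dots,X_r\subseteq C_0\cup C_1\cup\dots\cup C_d$ with $|X_i\cap C_j|\le1$ for all $i$ and $j$, there are $k$ indices $i_1<\dots<i_k$ with $\operatorname{conv}(X_{i_1})\cap\dots\cap\operatorname{conv}(X_{i_k})=\emptyset$.
   Formalization: The sets $C_0,C_1,\dots,C_d$ are taken in ℚ^d rather than ℝ^d, with rational weights in the convex hulls and empty intersection meaning that no rational point lies in all k hulls. -}

module Defs where

open import Data.Nat using (ℕ; zero; suc; pred)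
open import Data.Fin using (Fin; zero; suc)
open import Data.Rational using (ℚ; 0ℚ; 1ℚ; _+_; _*_; _≤_)
open import Data.Vec using (Vec; replicate; zipWith)
import Data.Vec as Vec
open import Data.Maybe using (Maybe; just; nothing)
import Data.Maybe as Maybe
open import Data.List using (List; mapMaybe; lookup; allFin)
open import Data.Product using (Σ; _×_; _,_)
open import Relation.Binary.PropositionalEquality using (_≡_; _≢_)

-- Points of ℚ^d (rational model of ℝ^d)
Point : ℕ → Set
Point d = Vec ℚ d

_⊕_ : ∀ {d} → Point d → Point d → Point d
_⊕_ = zipWith _+_

_·_ : ∀ {d} → ℚ → Point d → Point d
c · v = Vec.map (c *_) v

origin : ∀ {d} → Point d
origin {d} = replicate d 0ℚ

∑ℚ : ∀ {m} → (Fin m → ℚ) → ℚ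
∑ℚ {zero}  w = 0ℚ
∑ℚ {suc m} w = w zero + ∑ℚ (λ i → w (suc i))

∑pt : ∀ {d m} → (Fin m → Point d) → Point d
∑pt {d} {zero}  v = origin
∑pt {d} {suc m} v = v zero ⊕ ∑pt (λ i → v (suc i))

InConv : ∀ {d m} → (Fin m → Point d) → Point d → Set
InConv {d} {m} x p =
  Σ (Fin m → ℚ) λ w →
    (∀ i → 0ℚ ≤ w i) × (∑ℚ w ≡ 1ℚ) × (∑pt (λ i → w i · x i) ≡ p)

InConvList : ∀ {d} → List (Point d) → Point d → Set
InConvList L p = InConv (lookup L) p

size : ∀ {d} → ℕ → Fin (suc d) → ℕ
size r zero    = pred r
size r (suc _) = r

Config : ℕ → ℕ → Set
Config d r = (j : Fin (suc d)) → Fin (size r j) → Point d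

Label : ℕ → ℕ → Set
Label d r = Σ (Fin (suc d)) λ j → Fin (size r j)

-- all enumerated points are distinct: each C_j has exactly its size and the C_j are pairwise disjoint
Injective : ∀ {d r} → Config d r → Set
Injective {d} {r} C = (a b : Label d r) →
  C (Σ.proj₁ a) (Σ.proj₂ a) ≡ C (Σ.proj₁ b) (Σ.proj₂ b) → a ≡ b
  where open Data.Product

-- a subset X of C_0 ∪ … ∪ C_d with |X ∩ C_j| ≤ 1 for all j:
-- for each j, either no point or one chosen point of C_j
Selection : ℕ → ℕ → Set
Selection d r = (j : Fin (suc d)) → Maybe (Fin (size r j))

points : ∀ {d r} → Config d r → Selection d r → List (Point d)
points {d} C X = mapMaybe (λ j → Maybe.map (C j) (X j)) (allFin (suc d))

PairwiseDisjoint : ∀ {d r} → (Fin r → Selection d r) → Set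
PairwiseDisjoint {d} {r} X = (i i' : Fin r) → i ≢ i' →
  (j : Fin (suc d)) (x : Fin (size r j)) → X i j ≡ just x → X i' j ≢ just x

{-# OPTIONS --safe #-}
-- C₀ sits on the negative diagonal, at −(t+1)·(1,…,1), and C_{m+1} on the m-th coordinate
-- axis, at ±(M + t)·e_m: the first ⌈r/2⌉ points on the positive half-axis, the others on
-- the negative one, where M > r and M > d·r.  As |C₀| = r − 1, one of the disjoint sets,
-- X_{i₀}, misses C₀; take k consecutive indices containing i₀.  A common point p of the k
-- hulls lies in the box [−r, 0]^d: at most ⌈r/2⌉ < k of the chosen sets meet the positive
-- half of C_{m+1} and at most ⌊r/2⌋ < k its negative half, while all other points have m-th
-- coordinate in [−r, 0].  Weighting each coordinate by the sign of the point of X_{i₀} on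
-- that axis gives a linear functional that is ≥ M on X_{i₀}, hence at p, but ≤ d·r < M on
-- the box.
module Submission where

open import Defs
import Data.Nat as ℕ
open ℕ using (ℕ; zero; suc; pred; _∸_; ⌈_/2⌉)
import Data.Nat.Properties as ℕ
open import Data.Fin as Fin using (Fin; zero; suc; toℕ; fromℕ<)
import Data.Fin.Properties as Fin
open import Data.Maybe using (Maybe; just; nothing; maybe)
import Data.Maybe as Maybe
import Data.Maybe.Relation.Unary.All as MaybeAll
import Data.Maybe.Relation.Unary.All.Properties as MaybeAll
open import Data.Product using (Σ; Σ-syntax; ∃-syntax; _×_; _,_; proj₂)
import Data.Product as Product
open import Function using (_∘_)
open import Level using (0ℓ)
open import Relation.Binary using (Rel; Trichotomous; Irreflexive; tri<; tri≈; tri>)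
open import Relation.Binary.PropositionalEquality
open import Relation.Nullary using (¬_; Dec; yes; no)
open import Relation.Nullary.Negation using (contradiction)
import Relation.Nullary.Decidable as Dec

DisjointChoices : ∀ {k n} → (Fin k → Maybe (Fin n)) → Set
DisjointChoices Y = ∀ {a b t} → Y a ≡ just t → Y b ≡ just t → a ≡ b

disjoint-choices : ∀ {d r k} {X : Fin r → Selection d r} → PairwiseDisjoint X →
                   {f : Fin k → Fin r} → (∀ {a b} → f a ≡ f b → a ≡ b) →
                   ∀ j → DisjointChoices (λ a → X (f a) j)
disjoint-choices disjoint {f} f-injective j {a} {b} {t} Xfa≡t Xfb≡t with f a Fin.≟ f b
... | yes fa≡fb = f-injective fa≡fb
... | no  fa≢fb = contradiction Xfb≡t (disjoint (f a) (f b) fa≢fb j t Xfa≡t)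

some-choice-avoids : ∀ {k n B} {Y : Fin k → Maybe (Fin n)} → DisjointChoices Y →
                     (ρ : Fin n → ℕ) → (∀ {s t} → ρ s ≡ ρ t → s ≡ t) → B ℕ.< k →
                     ∃[ a ] MaybeAll.All (λ t → B ℕ.≤ ρ t) (Y a)
some-choice-avoids {k} {n} {B} {Y} disjoint ρ ρ-injective B<k =
  Product.map₂ avoids
    (Fin.¬∀⟶∃¬ k Hits hits? λ hit → ℕ.<⇒≱ B<k (Fin.injective⇒≤ (code-injective hit)))
  where
  Hits : Fin k → Set
  Hits a = ∃[ t ] Y a ≡ just t × ρ t ℕ.< B

  hits? : ∀ a → Dec (Hits a)
  hits? a with Y a
  ... | nothing = no λ ()
  ... | just t  = Dec.map′ (λ ρt<B → t , refl , ρt<B) (λ { (_ , refl , ρt<B) → ρt<B }) (ρ t ℕ.<? B)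

  avoids : ∀ {a} → ¬ Hits a → MaybeAll.All (λ t → B ℕ.≤ ρ t) (Y a)
  avoids {a} ¬hit with Y a
  ... | nothing = MaybeAll.nothing
  ... | just t  = MaybeAll.just (ℕ.≮⇒≥ λ ρt<B → ¬hit (t , refl , ρt<B))

  code : (∀ a → Hits a) → Fin k → Fin B
  code hit a = fromℕ< (proj₂ (proj₂ (hit a)))

  code-injective : (hit : ∀ a → Hits a) → ∀ {a b} → code hit a ≡ code hit b → a ≡ b
  code-injective hit {a} {b} code≡ with hit a | hit b
  ... | s , Ya≡s , ρs<B | t , Yb≡t , ρt<B =
    disjoint Ya≡s
      (trans Yb≡t (cong just (sym (ρ-injective (Fin.fromℕ<-injective _ _ ρs<B ρt<B code≡)))))

some-choice-empty : ∀ {k n} {Y : Fin k → Maybe (Fin n)} → DisjointChoices Y → n ℕ.< k →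
                    ∃[ a ] Y a ≡ nothing
some-choice-empty disjoint n<k = Product.map₂ empty (some-choice-avoids disjoint toℕ Fin.toℕ-injective n<k)
  where
  empty : ∀ {n} {y : Maybe (Fin n)} → MaybeAll.All (λ t → n ℕ.≤ toℕ t) y → y ≡ nothing
  empty MaybeAll.nothing        = refl
  empty (MaybeAll.just {t} n≤t) = contradiction (Fin.toℕ<n t) (ℕ.≤⇒≯ n≤t)

strictlyMonotone⇒injective : ∀ {A B : Set} {_<₁_ : Rel A 0ℓ} {_<₂_ : Rel B 0ℓ} →
  Trichotomous _≡_ _<₁_ → Irreflexive _≡_ _<₂_ →
  {f : A → B} → (∀ {x y} → x <₁ y → f x <₂ f y) → ∀ {x y} → f x ≡ f y → x ≡ y
strictlyMonotone⇒injective compare irrefl f-mono {x} {y} fx≡fy with compare x y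
... | tri< x<y _ _ = contradiction (f-mono x<y) (irrefl fx≡fy)
... | tri≈ _ x≡y _ = x≡y
... | tri> _ _ y<x = contradiction (f-mono y<x) (irrefl (sym fx≡fy))

StrictlyIncreasing : ∀ {k r} → (Fin k → Fin r) → Set
StrictlyIncreasing {k} f = (a b : Fin k) → a Fin.< b → f a Fin.< f b

window : ∀ {k r} → k ℕ.< r → (i : Fin r) →
         Σ[ f ∈ (Fin (suc k) → Fin r) ] StrictlyIncreasing f × ∃[ a ] f a ≡ i
window {k} {r} k<r i = f , f-increasing , a₀ , fa₀≡i
  where
  s : ℕ
  s = toℕ i ∸ k

  s+k<r : s ℕ.+ k ℕ.< r
  s+k<r with k ℕ.≤? toℕ i
  ... | yes k≤i = subst (ℕ._< r) (sym (ℕ.m∸n+n≡m k≤i)) (Fin.toℕ<n i)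
  ... | no  k≰i = subst (λ x → x ℕ.+ k ℕ.< r) (sym (ℕ.m≤n⇒m∸n≡0 (ℕ.<⇒≤ (ℕ.≰⇒> k≰i)))) k<r

  s+a<r : (a : Fin (suc k)) → s ℕ.+ toℕ a ℕ.< r
  s+a<r a = ℕ.≤-<-trans (ℕ.+-monoʳ-≤ s (Fin.toℕ≤pred[n] a)) s+k<r

  f : Fin (suc k) → Fin r
  f a = fromℕ< (s+a<r a)

  f-increasing : StrictlyIncreasing f
  f-increasing a b a<b = subst₂ ℕ._<_ (sym (Fin.toℕ-fromℕ< (s+a<r a))) (sym (Fin.toℕ-fromℕ< (s+a<r b)))
                                 (ℕ.+-monoʳ-< s a<b)

  i∸s<1+k : toℕ i ∸ s ℕ.< suc k
  i∸s<1+k = ℕ.s≤s (ℕ.m≤n+o⇒m∸n≤o (toℕ i) s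
    (subst (toℕ i ℕ.≤_) (ℕ.+-comm k s) (ℕ.m≤n+m∸n (toℕ i) k)))

  a₀ : Fin (suc k)
  a₀ = fromℕ< i∸s<1+k

  fa₀≡i : f a₀ ≡ i
  fa₀≡i = Fin.toℕ-injective (begin
    toℕ (f a₀)                 ≡⟨ Fin.toℕ-fromℕ< (s+a<r a₀) ⟩
    s ℕ.+ toℕ a₀               ≡⟨ cong (s ℕ.+_) (Fin.toℕ-fromℕ< i∸s<1+k) ⟩
    s ℕ.+ (toℕ i ∸ s)          ≡⟨ ℕ.m+[n∸m]≡n (ℕ.m∸n≤m (toℕ i) k) ⟩
    toℕ i                      ∎)
    where open ≡-Reasoning

module Geometry where

  open import Data.Rational as ℚ using (ℚ; 0ℚ; 1ℚ; _+_; _*_; -_; ∣_∣; _≤_; _<_)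
  open import Data.Rational.Properties
  open import Algebra.Bundles using (CommutativeMonoid)
  open import Algebra.Properties.CommutativeSemigroup
    (CommutativeMonoid.commutativeSemigroup +-0-commutativeMonoid) using (interchange)
  open import Algebra.Properties.CommutativeSemigroup
    (CommutativeMonoid.commutativeSemigroup *-1-commutativeMonoid) using (x∙yz≈y∙xz)
  open import Algebra.Properties.Group +-0-group using (⁻¹-involutive)
  open import Data.Sign using (Sign)
  open import Data.Vec using ([]; _∷_; lookup; replicate; _[_]≔_)
  import Data.Vec.Properties as Vec
  open import Data.List using (List)
  open import Data.List.Relation.Unary.All as All using (All)
  open import Data.List.Relation.Unary.All.Properties using (mapMaybe⁺; map⁺; tabulate⁺)
  open import Data.List.Membership.Propositional.Properties using (∈-lookup)

  ∑-mono : ∀ {m} {f g : Fin m → ℚ} → (∀ i → f i ≤ g i) → ∑ℚ f ≤ ∑ℚ g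
  ∑-mono {zero}  f≤g = ≤-refl
  ∑-mono {suc m} f≤g = +-mono-≤ (f≤g zero) (∑-mono (f≤g ∘ suc))

  ∑-*ʳ : ∀ {m} (f : Fin m → ℚ) c → ∑ℚ (λ i → f i * c) ≡ ∑ℚ f * c
  ∑-*ʳ {zero}  f c = sym (*-zeroˡ c)
  ∑-*ʳ {suc m} f c = trans (cong (f zero * c +_) (∑-*ʳ (f ∘ suc) c)) (sym (*-distribʳ-+ c (f zero) _))

  ∑-nonNeg : ∀ {m} {f : Fin m → ℚ} → (∀ i → 0ℚ ≤ f i) → 0ℚ ≤ ∑ℚ f
  ∑-nonNeg {zero}  f≥0 = ≤-refl
  ∑-nonNeg {suc m} f≥0 = +-mono-≤ (f≥0 zero) (∑-nonNeg (f≥0 ∘ suc))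

  weighted-∑-mono : ∀ {m} {w y z : Fin m → ℚ} → (∀ i → 0ℚ ≤ w i) → (∀ i → y i ≤ z i) →
                  ∑ℚ (λ i → w i * y i) ≤ ∑ℚ (λ i → w i * z i)
  weighted-∑-mono {w = w} w≥0 y≤z =
    ∑-mono (λ i → *-monoˡ-≤-nonNeg (w i) {{ℚ.nonNegative (w≥0 i)}} (y≤z i))

  convex-∑-const : ∀ {m} (w : Fin m → ℚ) → ∑ℚ w ≡ 1ℚ → ∀ c → ∑ℚ (λ i → w i * c) ≡ c
  convex-∑-const w ∑w≡1 c = trans (∑-*ʳ w c) (trans (cong (_* c) ∑w≡1) (*-identityˡ c))

  record Linear {d} (φ : Point d → ℚ) : Set where
    field
      ⊕-homo      : ∀ u v → φ (u ⊕ v) ≡ φ u + φ v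
      ·-homo      : ∀ c v → φ (c · v) ≡ c * φ v
      origin-homo : φ origin ≡ 0ℚ

    ∑-homo : ∀ {m} (w : Fin m → ℚ) (x : Fin m → Point d) →
             φ (∑pt (λ i → w i · x i)) ≡ ∑ℚ (λ i → w i * φ (x i))
    ∑-homo {zero}  w x = origin-homo
    ∑-homo {suc m} w x = begin
      φ ((w zero · x zero) ⊕ ∑pt (λ i → w (suc i) · x (suc i)))
        ≡⟨ ⊕-homo _ _ ⟩
      φ (w zero · x zero) + φ (∑pt (λ i → w (suc i) · x (suc i)))
        ≡⟨ cong₂ _+_ (·-homo (w zero) (x zero)) (∑-homo (w ∘ suc) (x ∘ suc)) ⟩
      w zero * φ (x zero) + ∑ℚ (λ i → w (suc i) * φ (x (suc i)))
        ∎
      where open ≡-Reasoning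

    lower-bound-on-hull : ∀ {m} {x : Fin m → Point d} {p c} →
                          InConv x p → (∀ i → c ≤ φ (x i)) → c ≤ φ p
    lower-bound-on-hull {x = x} {p} {c} (w , w≥0 , ∑w≡1 , ∑wx≡p) c≤φx = begin
      c                            ≡⟨ convex-∑-const w ∑w≡1 c ⟨
      ∑ℚ (λ i → w i * c)           ≤⟨ weighted-∑-mono w≥0 c≤φx ⟩
      ∑ℚ (λ i → w i * φ (x i))     ≡⟨ ∑-homo w x ⟨
      φ (∑pt (λ i → w i · x i))    ≡⟨ cong φ ∑wx≡p ⟩
      φ p                          ∎
      where open ≤-Reasoning

    upper-bound-on-hull : ∀ {m} {x : Fin m → Point d} {p c} →
                          InConv x p → (∀ i → φ (x i) ≤ c) → φ p ≤ c
    upper-bound-on-hull {x = x} {p} {c} (w , w≥0 , ∑w≡1 , ∑wx≡p) φx≤c = begin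
      φ p                          ≡⟨ cong φ ∑wx≡p ⟨
      φ (∑pt (λ i → w i · x i))    ≡⟨ ∑-homo w x ⟩
      ∑ℚ (λ i → w i * φ (x i))     ≤⟨ weighted-∑-mono w≥0 φx≤c ⟩
      ∑ℚ (λ i → w i * c)           ≡⟨ convex-∑-const w ∑w≡1 c ⟩
      c                            ∎
      where open ≤-Reasoning

    lower-bound-on-hull-of-list : ∀ {L : List (Point d)} {p c} →
                                  InConvList L p → All (λ y → c ≤ φ y) L → c ≤ φ p
    lower-bound-on-hull-of-list p∈hull c≤φL = lower-bound-on-hull p∈hull (All.lookup c≤φL ∘ ∈-lookup)

    upper-bound-on-hull-of-list : ∀ {L : List (Point d)} {p c} →
                                  InConvList L p → All (λ y → φ y ≤ c) L → φ p ≤ c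
    upper-bound-on-hull-of-list p∈hull φL≤c = upper-bound-on-hull p∈hull (All.lookup φL≤c ∘ ∈-lookup)

  coord-linear : ∀ {d} (m : Fin d) → Linear (λ v → lookup v m)
  coord-linear m = record
    { ⊕-homo      = Vec.lookup-zipWith _+_ m
    ; ·-homo      = λ c → Vec.lookup-map m (c *_)
    ; origin-homo = Vec.lookup-replicate m 0ℚ
    }

  dot : ∀ {d} → (Fin d → ℚ) → Point d → ℚ
  dot w v = ∑ℚ (λ i → w i * lookup v i)

  dot-origin : ∀ {d} (w : Fin d → ℚ) → dot w origin ≡ 0ℚ
  dot-origin {zero}  w = refl
  dot-origin {suc d} w = cong₂ _+_ (*-zeroʳ (w zero)) (dot-origin (w ∘ suc))

  dot-linear : ∀ {d} (w : Fin d → ℚ) → Linear (dot w)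
  dot-linear w = record { ⊕-homo = dot-⊕ w ; ·-homo = dot-· w ; origin-homo = dot-origin w }
    where
    dot-⊕ : ∀ {d} (w : Fin d → ℚ) u v → dot w (u ⊕ v) ≡ dot w u + dot w v
    dot-⊕ w []      []      = refl
    dot-⊕ w (x ∷ u) (y ∷ v) =
      trans (cong₂ _+_ (*-distribˡ-+ (w zero) x y) (dot-⊕ (w ∘ suc) u v))
            (interchange (w zero * x) (w zero * y) (dot (w ∘ suc) u) (dot (w ∘ suc) v))
    dot-· : ∀ {d} (w : Fin d → ℚ) c v → dot w (c · v) ≡ c * dot w v
    dot-· w c []      = sym (*-zeroʳ c)
    dot-· w c (x ∷ v) =
      trans (cong₂ _+_ (x∙yz≈y∙xz (w zero) c x) (dot-· (w ∘ suc) c v)) (sym (*-distribˡ-+ c _ _))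

  dot-axis : ∀ {d} (w : Fin d → ℚ) m x → dot w (origin [ m ]≔ x) ≡ w m * x
  dot-axis w zero    x = trans (cong (w zero * x +_) (dot-origin (w ∘ suc))) (+-identityʳ _)
  dot-axis w (suc m) x = trans (cong₂ _+_ (*-zeroʳ (w zero)) (dot-axis (w ∘ suc) m x)) (+-identityˡ _)

  all-points : ∀ {d r} (C : Config d r) (S : Selection d r) {P : Point d → Set} →
               (∀ j → MaybeAll.All (P ∘ C j) (S j)) → All P (points C S)
  all-points C S P-selected =
    mapMaybe⁺ (map⁺ (tabulate⁺ {f = λ j → j} (λ j → MaybeAll.map⁺ (P-selected j))))

  x≤y⇒x<1+y : ∀ {x y} → x ≤ y → x < 1ℚ + y
  x≤y⇒x<1+y {x} x≤y = subst (_< _) (+-identityˡ x) (+-mono-<-≤ (positive⁻¹ 1ℚ) x≤y)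

  fromℕ : ℕ → ℚ
  fromℕ zero    = 0ℚ
  fromℕ (suc n) = 1ℚ + fromℕ n

  fromℕ-nonNeg : ∀ n → 0ℚ ≤ fromℕ n
  fromℕ-nonNeg zero    = ≤-refl
  fromℕ-nonNeg (suc n) = +-mono-≤ (nonNegative⁻¹ 1ℚ) (fromℕ-nonNeg n)

  fromℕ-mono-≤ : ∀ {m n} → m ℕ.≤ n → fromℕ m ≤ fromℕ n
  fromℕ-mono-≤ {n = n} ℕ.z≤n = fromℕ-nonNeg n
  fromℕ-mono-≤ (ℕ.s≤s m≤n)   = +-monoʳ-≤ 1ℚ (fromℕ-mono-≤ m≤n)

  fromℕ-mono-< : ∀ {m n} → m ℕ.< n → fromℕ m < fromℕ n
  fromℕ-mono-< {zero}  {suc n} _             = +-mono-<-≤ (positive⁻¹ 1ℚ) (fromℕ-nonNeg n)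
  fromℕ-mono-< {suc m} {suc n} (ℕ.s≤s m<n)   = +-monoʳ-< 1ℚ (fromℕ-mono-< m<n)

  fromℕ-injective : ∀ {m n} → fromℕ m ≡ fromℕ n → m ≡ n
  fromℕ-injective = strictlyMonotone⇒injective ℕ.<-cmp <-irrefl fromℕ-mono-<

  ⟦_⟧ : Sign → ℚ
  ⟦ Sign.+ ⟧ = 1ℚ
  ⟦ Sign.- ⟧ = - 1ℚ

  ⟦s⟧*⟦s⟧*x≡x : ∀ s x → ⟦ s ⟧ * (⟦ s ⟧ * x) ≡ x
  ⟦s⟧*⟦s⟧*x≡x s x =
    trans (sym (*-assoc ⟦ s ⟧ ⟦ s ⟧ x)) (trans (cong (_* x) (⟦s⟧*⟦s⟧≡1 s)) (*-identityˡ x))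
    where
    ⟦s⟧*⟦s⟧≡1 : ∀ s → ⟦ s ⟧ * ⟦ s ⟧ ≡ 1ℚ
    ⟦s⟧*⟦s⟧≡1 Sign.+ = refl
    ⟦s⟧*⟦s⟧≡1 Sign.- = refl

  ∣⟦s⟧*x∣≡∣x∣ : ∀ s x → ∣ ⟦ s ⟧ * x ∣ ≡ ∣ x ∣
  ∣⟦s⟧*x∣≡∣x∣ s x =
    trans (∣p*q∣≡∣p∣*∣q∣ ⟦ s ⟧ x) (trans (cong (_* ∣ x ∣) (∣⟦s⟧∣≡1 s)) (*-identityˡ ∣ x ∣))
    where
    ∣⟦s⟧∣≡1 : ∀ s → ∣ ⟦ s ⟧ ∣ ≡ 1ℚ
    ∣⟦s⟧∣≡1 Sign.+ = refl
    ∣⟦s⟧∣≡1 Sign.- = refl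

  -1*x≡-x : ∀ x → - 1ℚ * x ≡ - x
  -1*x≡-x x = trans (sym (neg-distribˡ-* 1ℚ x)) (cong -_ (*-identityˡ x))

  weight : Maybe Sign → ℚ
  weight = maybe ⟦_⟧ 0ℚ

  weight-bound : ∀ σ {y B} → 0ℚ ≤ B → - B ≤ y → y ≤ 0ℚ → weight σ * y ≤ B
  weight-bound nothing       {y}     0≤B _    _   = ≤-trans (≤-reflexive (*-zeroˡ y)) 0≤B
  weight-bound (just Sign.+) {y}     0≤B _    y≤0 = ≤-trans (≤-reflexive (*-identityˡ y)) (≤-trans y≤0 0≤B)
  weight-bound (just Sign.-) {y} {B} _   -B≤y _   = begin
    - 1ℚ * y     ≡⟨ -1*x≡-x y ⟩
    - y          ≤⟨ neg-antimono-≤ -B≤y ⟩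
    - (- B)      ≡⟨ ⁻¹-involutive B ⟩
    B            ∎
    where open ≤-Reasoning

  module Construction (d r : ℕ) where

    h : ℕ
    h = ⌈ r /2⌉

    R S M : ℚ
    R = fromℕ r
    S = ∑ℚ {d} (λ _ → R)
    M = 1ℚ + (R + S)

    V : Fin r → ℚ
    V t = M + fromℕ (toℕ t)

    side : Fin r → Sign
    side t with toℕ t ℕ.<? h
    ... | yes _ = Sign.+
    ... | no  _ = Sign.-

    val : Fin r → ℚ
    val t = ⟦ side t ⟧ * V t

    C : Config d r
    C zero    t = replicate d (- fromℕ (suc (toℕ t)))
    C (suc m) t = origin [ m ]≔ val t

    S≥0 : 0ℚ ≤ S
    S≥0 = ∑-nonNeg {d} (λ _ → fromℕ-nonNeg r)

    R<M : R < M
    R<M = x≤y⇒x<1+y (≤-trans (≤-reflexive (sym (+-identityʳ R))) (+-monoʳ-≤ R S≥0))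

    S<M : S < M
    S<M = x≤y⇒x<1+y (≤-trans (≤-reflexive (sym (+-identityˡ S))) (+-monoˡ-≤ S (fromℕ-nonNeg r)))

    M≤V : ∀ t → M ≤ V t
    M≤V t = ≤-trans (≤-reflexive (sym (+-identityʳ M))) (+-monoʳ-≤ M (fromℕ-nonNeg (toℕ t)))

    0<V : ∀ t → 0ℚ < V t
    0<V t = ≤-<-trans (fromℕ-nonNeg r) (<-≤-trans R<M (M≤V t))

    V-injective : ∀ {s t} → V s ≡ V t → s ≡ t
    V-injective = strictlyMonotone⇒injective Fin.<-cmp <-irrefl (λ s<t → +-monoʳ-< M (fromℕ-mono-< s<t))

    side≡+ : ∀ {t} → toℕ t ℕ.< h → side t ≡ Sign.+
    side≡+ {t} t<h with toℕ t ℕ.<? h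
    ... | yes _   = refl
    ... | no  t≮h = contradiction t<h t≮h

    side≡- : ∀ {t} → h ℕ.≤ toℕ t → side t ≡ Sign.-
    side≡- {t} h≤t with toℕ t ℕ.<? h
    ... | yes t<h = contradiction t<h (ℕ.≤⇒≯ h≤t)
    ... | no  _   = refl

    ∣val∣≡V : ∀ t → ∣ val t ∣ ≡ V t
    ∣val∣≡V t = trans (∣⟦s⟧*x∣≡∣x∣ (side t) (V t)) (0≤p⇒∣p∣≡p (<⇒≤ (0<V t)))

    val-injective : ∀ {s t} → val s ≡ val t → s ≡ t
    val-injective {s} {t} eq = V-injective (trans (sym (∣val∣≡V s)) (trans (cong ∣_∣ eq) (∣val∣≡V t)))

    val≢0 : ∀ t → val t ≢ 0ℚ
    val≢0 t eq = <-irrefl (sym (trans (sym (∣val∣≡V t)) (cong ∣_∣ eq))) (0<V t)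

    0≤val : ∀ {t} → toℕ t ℕ.< h → 0ℚ ≤ val t
    0≤val {t} t<h rewrite side≡+ t<h = ≤-trans (<⇒≤ (0<V t)) (≤-reflexive (sym (*-identityˡ (V t))))

    val≤0 : ∀ {t} → h ℕ.≤ toℕ t → val t ≤ 0ℚ
    val≤0 {t} h≤t rewrite side≡- h≤t =
      ≤-trans (≤-reflexive (-1*x≡-x (V t))) (<⇒≤ (neg-antimono-< (0<V t)))

    1+t≤r : ∀ (t : Fin (pred r)) → suc (toℕ t) ℕ.≤ r
    1+t≤r t = ℕ.≤-trans (Fin.toℕ<n t) ℕ.pred[n]≤n

    C₀-coord : ∀ t m → lookup (C zero t) m ≡ - fromℕ (suc (toℕ t))
    C₀-coord t m = Vec.lookup-replicate m _

    axis-coord : ∀ m t → lookup (C (suc m) t) m ≡ val t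
    axis-coord m t = Vec.lookup∘update m origin (val t)

    off-axis-coord : ∀ {m m′} t → m ≢ m′ → lookup (C (suc m′) t) m ≡ 0ℚ
    off-axis-coord {m} t m≢m′ = trans (Vec.lookup∘update′ m≢m′ origin (val t)) (Vec.lookup-replicate m 0ℚ)

    C₀-coord≢val : ∀ s t → - fromℕ (suc (toℕ s)) ≢ val t
    C₀-coord≢val s t eq = <-irrefl (trans (cong ∣_∣ eq) (∣val∣≡V t)) (begin-strict
      ∣ - fromℕ (suc (toℕ s)) ∣   ≡⟨ trans (∣-p∣≡∣p∣ _) (0≤p⇒∣p∣≡p (fromℕ-nonNeg (suc (toℕ s)))) ⟩
      fromℕ (suc (toℕ s))         ≤⟨ fromℕ-mono-≤ (1+t≤r s) ⟩
      R                           <⟨ R<M ⟩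
      M                           ≤⟨ M≤V t ⟩
      V t                         ∎)
      where open ≤-Reasoning

    C₀-coord-injective : ∀ {s t : Fin (pred r)} →
                         - fromℕ (suc (toℕ s)) ≡ - fromℕ (suc (toℕ t)) → s ≡ t
    C₀-coord-injective eq = Fin.toℕ-injective (ℕ.suc-injective (fromℕ-injective (neg-injective eq)))

    coord-cong : ∀ {u v : Point d} m → u ≡ v → lookup u m ≡ lookup v m
    coord-cong m = cong (λ v → lookup v m)

    C-injective : Fin d → Injective C
    C-injective m₀ (zero , s) (zero , t) eq = cong (zero ,_) (C₀-coord-injective
      (trans (sym (C₀-coord s m₀)) (trans (coord-cong m₀ eq) (C₀-coord t m₀))))
    C-injective m₀ (zero , s) (suc m , t) eq = contradiction
      (trans (sym (C₀-coord s m)) (trans (coord-cong m eq) (axis-coord m t))) (C₀-coord≢val s t)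
    C-injective m₀ (suc m , s) (zero , t) eq = contradiction
      (trans (sym (C₀-coord t m)) (trans (coord-cong m (sym eq)) (axis-coord m s))) (C₀-coord≢val t s)
    C-injective m₀ (suc m , s) (suc m′ , t) eq with m Fin.≟ m′
    ... | yes refl = cong (suc m ,_)
      (val-injective (trans (sym (axis-coord m s)) (trans (coord-cong m eq) (axis-coord m t))))
    ... | no  m≢m′ = contradiction
      (trans (sym (axis-coord m s)) (trans (coord-cong m eq) (off-axis-coord t m≢m′))) (val≢0 s)

    coords-≤0 : ∀ m (X : Selection d r) → MaybeAll.All (λ t → h ℕ.≤ toℕ t) (X (suc m)) →
                ∀ j → MaybeAll.All (λ t → lookup (C j t) m ≤ 0ℚ) (X j)
    coords-≤0 m X negative zero = MaybeAll.universal
      (λ t → ≤-trans (≤-reflexive (C₀-coord t m)) (neg-antimono-≤ (fromℕ-nonNeg (suc (toℕ t))))) (X zero)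
    coords-≤0 m X negative (suc m′) with m Fin.≟ m′
    ... | yes refl = MaybeAll.map
      (λ {t} h≤t → ≤-trans (≤-reflexive (axis-coord m t)) (val≤0 h≤t)) negative
    ... | no  m≢m′ = MaybeAll.universal (λ t → ≤-reflexive (off-axis-coord t m≢m′)) (X (suc m′))

    -R≤0 : - R ≤ 0ℚ
    -R≤0 = neg-antimono-≤ (fromℕ-nonNeg r)

    coords-≥-R : ∀ m (X : Selection d r) → MaybeAll.All (λ t → toℕ t ℕ.< h) (X (suc m)) →
                 ∀ j → MaybeAll.All (λ t → - R ≤ lookup (C j t) m) (X j)
    coords-≥-R m X positive zero = MaybeAll.universal
      (λ t → ≤-trans (neg-antimono-≤ (fromℕ-mono-≤ (1+t≤r t))) (≤-reflexive (sym (C₀-coord t m)))) (X zero)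
    coords-≥-R m X positive (suc m′) with m Fin.≟ m′
    ... | yes refl = MaybeAll.map
      (λ {t} t<h → ≤-trans -R≤0 (≤-trans (0≤val t<h) (≤-reflexive (sym (axis-coord m t))))) positive
    ... | no  m≢m′ = MaybeAll.universal
      (λ t → ≤-trans -R≤0 (≤-reflexive (sym (off-axis-coord t m≢m′)))) (X (suc m′))

    weights : Selection d r → Fin d → ℚ
    weights X m = weight (Maybe.map side (X (suc m)))

    weights-on-selection : ∀ (X : Selection d r) → X zero ≡ nothing →
                           ∀ j → MaybeAll.All (λ t → M ≤ dot (weights X) (C j t)) (X j)
    weights-on-selection X X₀≡∅ zero    = subst (MaybeAll.All _) (sym X₀≡∅) MaybeAll.nothing
    weights-on-selection X X₀≡∅ (suc m) = MaybeAll.map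
      (λ {t} ±val≡V → ≤-trans (M≤V t) (≤-reflexive (sym (trans (dot-axis (weights X) m (val t)) ±val≡V))))
      (signed-val (X (suc m)))
      where
      signed-val : ∀ y → MaybeAll.All (λ t → weight (Maybe.map side y) * val t ≡ V t) y
      signed-val nothing  = MaybeAll.nothing
      signed-val (just t) = MaybeAll.just (⟦s⟧*⟦s⟧*x≡x (side t) (V t))

    M≤dot-on-hull : ∀ (X : Selection d r) {p} → X zero ≡ nothing → InConvList (points C X) p →
                    M ≤ dot (weights X) p
    M≤dot-on-hull X X₀≡∅ p∈hull = Linear.lower-bound-on-hull-of-list (dot-linear (weights X)) p∈hull
      (all-points C X (weights-on-selection X X₀≡∅))

    dot≤S-on-box : ∀ (X : Selection d r) p → (∀ m → - R ≤ lookup p m) → (∀ m → lookup p m ≤ 0ℚ) →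
                   dot (weights X) p ≤ S
    dot≤S-on-box X p lower upper =
      ∑-mono (λ m → weight-bound (Maybe.map side (X (suc m))) (fromℕ-nonNeg r) (lower m) (upper m))

    -- reversed t < r ∸ h exactly when h ≤ toℕ t, i.e. when val t is negative.
    reversed : Fin r → ℕ
    reversed t = r ∸ suc (toℕ t)

    reversed-injective : ∀ {s t} → reversed s ≡ reversed t → s ≡ t
    reversed-injective {s} {t} eq =
      Fin.toℕ-injective (ℕ.suc-injective (ℕ.∸-cancelˡ-≡ (Fin.toℕ<n s) (Fin.toℕ<n t) eq))

    module _ {k} {X : Fin r → Selection d r} (disjoint : PairwiseDisjoint X)
             {f : Fin k → Fin r} (f-injective : ∀ {a b} → f a ≡ f b → a ≡ b)
             {p : Point d} (p∈hulls : ∀ a → InConvList (points C (X (f a))) p) where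

      common-point-≤0 : h ℕ.< k → ∀ m → lookup p m ≤ 0ℚ
      common-point-≤0 h<k m
        with some-choice-avoids (disjoint-choices disjoint f-injective (suc m)) toℕ Fin.toℕ-injective h<k
      ... | a , negative = Linear.upper-bound-on-hull-of-list (coord-linear m) (p∈hulls a)
        (all-points C (X (f a)) (coords-≤0 m (X (f a)) negative))

      common-point-≥-R : r ∸ h ℕ.< k → ∀ m → - R ≤ lookup p m
      common-point-≥-R r∸h<k m
        with some-choice-avoids (disjoint-choices disjoint f-injective (suc m)) reversed reversed-injective r∸h<k
      ... | a , nonnegative = Linear.lower-bound-on-hull-of-list (coord-linear m) (p∈hulls a)
        (all-points C (X (f a)) (coords-≥-R m (X (f a)) positive))
        where
        positive : MaybeAll.All (λ t → toℕ t ℕ.< h) (X (f a) (suc m))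
        positive = MaybeAll.map (λ {t} → ℕ.∸-cancelʳ-≤ (Fin.toℕ<n t)) nonnegative

    r∸h≤h : r ∸ h ℕ.≤ h
    r∸h≤h = ℕ.m≤n+o⇒m∸n≤o r h
      (subst (ℕ._≤ h ℕ.+ h) (ℕ.⌊n/2⌋+⌈n/2⌉≡n r) (ℕ.+-monoˡ-≤ h (ℕ.⌊n/2⌋≤⌈n/2⌉ r)))

    some-selection-misses-C₀ : 0 ℕ.< r → (X : Fin r → Selection d r) → PairwiseDisjoint X →
                               ∃[ i ] X i zero ≡ nothing
    some-selection-misses-C₀ 0<r X disjoint = some-choice-empty (disjoint-choices disjoint (λ eq → eq) zero)
      (ℕ.m≤pred[n]⇒suc[m]≤n {{ℕ.>-nonZero 0<r}} ℕ.≤-refl)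

    no-common-point : ∀ {k} {X : Fin r → Selection d r} → PairwiseDisjoint X → h ℕ.< k →
                      {f : Fin k → Fin r} → StrictlyIncreasing f → ∀ {a} → X (f a) zero ≡ nothing →
                      ¬ (Σ (Point d) λ p → (a : Fin k) → InConvList (points C (X (f a))) p)
    no-common-point {X = X} disjoint h<k {f} f-increasing {a} Xfa≡∅ (p , p∈hulls) =
      <-irrefl refl (begin-strict
        S                          <⟨ S<M ⟩
        M                          ≤⟨ M≤dot-on-hull (X (f a)) Xfa≡∅ (p∈hulls a) ⟩
        dot (weights (X (f a))) p  ≤⟨ dot≤S-on-box (X (f a)) p lower upper ⟩
        S                          ∎)
      where
      open ≤-Reasoning

      f-injective : ∀ {a b} → f a ≡ f b → a ≡ b
      f-injective = strictlyMonotone⇒injective Fin.<-cmp Fin.<-irrefl (λ {a} {b} → f-increasing a b)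
      lower : ∀ m → - R ≤ lookup p m
      lower = common-point-≥-R disjoint f-injective p∈hulls (ℕ.≤-<-trans r∸h≤h h<k)
      upper : ∀ m → lookup p m ≤ 0ℚ
      upper = common-point-≤0 disjoint f-injective p∈hulls h<k

open import Data.Nat using (ℕ; _≤_; _<_; ⌈_/2⌉)

theorem3p2 : (d r k : ℕ) → 1 ≤ d → 2 ≤ r → ⌈ r /2⌉ < k → k ≤ r →
    Σ (Config d r) λ C → Injective C ×
      ((X : Fin r → Selection d r) → PairwiseDisjoint X →
        Σ (Fin k → Fin r) λ f →
          ((a b : Fin k) → a Fin.< b → f a Fin.< f b) ×
          ¬ (Σ (Point d) λ p → (a : Fin k) → InConvList (points C (X (f a))) p))
theorem3p2 d r zero    _   _   ()  _
theorem3p2 d r (suc k) 1≤d 2≤r h<k k<r = C , C-injective (fromℕ< 1≤d) , separate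
  where
  open Geometry.Construction d r

  separate : (X : Fin r → Selection d r) → PairwiseDisjoint X →
             Σ[ f ∈ (Fin (suc k) → Fin r) ] StrictlyIncreasing f ×
               ¬ (Σ (Point d) λ p → (a : Fin (suc k)) → InConvList (points C (X (f a))) p)
  separate X disjoint with some-selection-misses-C₀ (ℕ.<⇒≤ 2≤r) X disjoint
  ... | i₀ , Xi₀-misses-C₀ with window k<r i₀
  ... | f , f-increasing , a₀ , fa₀≡i₀ =
    f , f-increasing , no-common-point disjoint h<k f-increasing {a₀}
                         (subst (λ i → X i zero ≡ nothing) (sym fa₀≡i₀) Xi₀-misses-C₀)
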